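{- For all packed words $a,b,c$ with $c\ne\varepsilon$, $a\triangleleft_R(b\triangleleft_B c)=b\triangleleft_B(a\triangleleft_R c)$; moreover $a\triangleleft_R 1=a\triangleleft_B 1$, where $1$ is the packed word of length one.
   Context: Words over positive integers; $|w|$ length, $\max(w)$ largest letter ($\max(\varepsilon)=0$), $w^{[k]}$ adds $k$ to every letter. Packed: every integer $1..\max(w)$ occurs. $u\odot v=u^{[\max(v)]}\cdot v$. Red: for packed $w$ of length $n$, $p\ge1$, $I=\{i_1<\dots<i_p\}\subseteq\{1..n+p\}$, $\phi_I(w)$ is the word of length $n+p$ with letter $\max(w)+1$ at positions of $I$ and letters of $w$ in order elsewhere; each nonempty packed $v$ is uniquely $\phi_I(v')$, and $u\triangleleft_R v=\phi_{I+|u|}(u\odot v')$ with $I+|u|=\{i+|u|:i\in I\}$. Blue: $\psi_{i^\circ}(w)$ ($1\le i\le\max(w)+1$) adds $1$ to each letter $\ge i$ and appends $i$; $\psi_{i^\bullet}(w)=w\cdot i$ ($1\le i\le\max(w)$); each nonempty packed $v$ is uniquely $\psi_{i^\alpha}(v')$, and $u\triangleleft_B v=\psi_{(i+\max(u))^\alpha}(v'\odot u)$. -}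

module Defs where

open import Data.Bool using (Bool; true; false; if_then_else_)
open import Data.Nat using (ℕ; zero; suc; _+_; _∸_; _⊔_; _≤_; _≡ᵇ_; _<ᵇ_; _≤ᵇ_)
open import Data.List using (List; []; _∷_; _++_; [_]; map; foldr; length; replicate; unsnoc)
open import Data.List.Relation.Unary.All using (All)
open import Data.List.Membership.Propositional using (_∈_)
open import Data.Maybe using (just; nothing)
open import Data.Product using (_×_; _,_)
open import Relation.Nullary using (¬_)
open import Relation.Binary.PropositionalEquality using (_≡_)

Word : Set
Word = List ℕ

maxW : Word → ℕ
maxW = foldr _⊔_ 0

shiftW : ℕ → Word → Word
shiftW k = map (k +_)

Packed : Word → Set
Packed w = All (1 ≤_) w × (∀ k → 1 ≤ k → k ≤ maxW w → k ∈ w)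

_⊙_ : Word → Word → Word
u ⊙ v = shiftW (maxW v) u ++ v

-- φ_I(w): the set I ⊆ {1..n+p} is given by its characteristic list of
-- length n+p (true at positions in I); new letter is max(w)+1.
phiAux : ℕ → List Bool → Word → Word
phiAux m [] w = []
phiAux m (true ∷ I) w = suc m ∷ phiAux m I w
phiAux m (false ∷ I) [] = []
phiAux m (false ∷ I) (x ∷ w) = x ∷ phiAux m I w

φ : List Bool → Word → Word
φ I w = phiAux (maxW w) I w

-- red decomposition v = φ_I(v'): I = positions of max(v), v' = v without them
redI : Word → List Bool
redI v = map (λ x → x ≡ᵇ maxW v) v

redV' : Word → Word
redV' v = dropVal (maxW v) v
  where
  dropVal : ℕ → Word → Word
  dropVal m [] = []
  dropVal m (x ∷ w) = if x ≡ᵇ m then dropVal m w else x ∷ dropVal m w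

-- u ◁_R v = φ_{I+|u|}(u ⊙ v')   (shifting I by |u| = prefixing |u| falses)
_◁R_ : Word → Word → Word
u ◁R v = φ (replicate (length u) false ++ redI v) (u ⊙ redV' v)

occurs : ℕ → Word → Bool
occurs i [] = false
occurs i (x ∷ w) = if x ≡ᵇ i then true else occurs i w

ψ∘ : ℕ → Word → Word
ψ∘ i w = map (λ x → if i ≤ᵇ x then suc x else x) w ++ [ i ]

ψ• : ℕ → Word → Word
ψ• i w = w ++ [ i ]

-- blue decomposition v = ψ_{i^α}(v'): i = last letter of v;
-- α = • iff i occurs earlier in v (then v' = prefix),
-- otherwise α = ∘ and v' = prefix with letters > i decreased by 1.
-- u ◁_B v = ψ_{(i+max u)^α}(v' ⊙ u).  (For v = ε the value is irrelevant.)
_◁B_ : Word → Word → Word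
u ◁B v with unsnoc v
... | nothing = []
... | just (p , i) =
  if occurs i p
  then ψ• (i + maxW u) (p ⊙ u)
  else ψ∘ (i + maxW u) (map (λ x → if i <ᵇ x then x ∸ 1 else x) p ⊙ u)

-- Both products have closed forms.  If v is packed with maximum m ≥ 1, then a ◁R v is
-- a^[m-1] followed by v with every letter m raised to m + max a; and for any b and
-- c = p·i with i ≥ 1, b ◁B c = p^[max b] · b · (max b + i), whichever of ψ• or ψ∘ applies.
-- Substituting, both sides of the first identity become
-- a^[max b + m - 1] · p'^[max b] · b · (max b + i'), where p'·i' is c with m raised to
-- m + max a; the second identity is the case c = 1 of the same forms.
module Submission where

open import Defs
open import Data.List using (List; []; [_])
open import Data.Nat using (ℕ)
open import Data.Product using (_×_)
open import Relation.Binary.PropositionalEquality using (_≡_; _≢_)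

open import Data.Bool using (Bool; true; false; if_then_else_)
open import Data.Empty using (⊥-elim)
open import Data.List using (_∷_; _++_; map; length; replicate; unsnoc; initLast; _∷ʳ′_)
open import Data.List.Properties using (map-++; ++-assoc; length-map; map-id; map-id-local; map-cong; map-cong-local; map-∘)
open import Data.List.Relation.Unary.All as All using (All; []; _∷_)
import Data.List.Relation.Unary.All.Properties as All
open import Data.List.Relation.Unary.Any using (here; there)
open import Data.List.Membership.Propositional using (_∈_)
open import Data.List.Membership.Propositional.Properties using (∈-++⁺ˡ; ∈-++⁺ʳ; ∈-++⁻; ∈-map⁺)
open import Data.Maybe using (just)
open import Data.Nat using (zero; suc; _+_; _∸_; _⊔_; _≤_; _<_; _≡ᵇ_; _<ᵇ_; _≤ᵇ_; z≤n; s≤s; s≤s⁻¹)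
open import Data.Nat.Properties
open import Data.Product using (_,_; proj₁; ∃₂)
open import Data.Sum using (inj₁; inj₂)
open import Function using (_∘_)
open import Relation.Nullary.Reflects using (Reflects; ofʸ; ofⁿ; fromEquivalence)
open import Relation.Binary.PropositionalEquality using (refl; sym; trans; cong; cong₂; subst; module ≡-Reasoning)

≡ᵇ-reflects-≡ : ∀ m n → Reflects (m ≡ n) (m ≡ᵇ n)
≡ᵇ-reflects-≡ m n = fromEquivalence (≡ᵇ⇒≡ m n) (≡⇒≡ᵇ m n)

maxW-++ : ∀ u v → maxW (u ++ v) ≡ maxW u ⊔ maxW v
maxW-++ [] v = refl
maxW-++ (x ∷ u) v = trans (cong (x ⊔_) (maxW-++ u v)) (sym (⊔-assoc x (maxW u) (maxW v)))

maxW-∷ʳ : ∀ u x → maxW (u ++ [ x ]) ≡ maxW u ⊔ x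
maxW-∷ʳ u x = trans (maxW-++ u [ x ]) (cong (maxW u ⊔_) (⊔-identityʳ x))

maxW-shiftW : ∀ k u → maxW (shiftW k u) ⊔ k ≡ k + maxW u
maxW-shiftW k [] = sym (+-identityʳ k)
maxW-shiftW k (x ∷ u) = begin
  (k + x) ⊔ maxW (shiftW k u) ⊔ k   ≡⟨ ⊔-assoc (k + x) _ k ⟩
  (k + x) ⊔ (maxW (shiftW k u) ⊔ k) ≡⟨ cong ((k + x) ⊔_) (maxW-shiftW k u) ⟩
  (k + x) ⊔ (k + maxW u)            ≡⟨ +-distribˡ-⊔ k x (maxW u) ⟨
  k + (x ⊔ maxW u)                  ∎
  where open ≡-Reasoning

maxW-⊙ : ∀ u v → maxW (u ⊙ v) ≡ maxW v + maxW u
maxW-⊙ u v = trans (maxW-++ (shiftW (maxW v) u) v) (maxW-shiftW (maxW v) u)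

All-≤-maxW : ∀ w → All (_≤ maxW w) w
All-≤-maxW [] = []
All-≤-maxW (x ∷ w) = m≤m⊔n x (maxW w) ∷ All.map (λ h → ≤-trans h (m≤n⊔m x (maxW w))) (All-≤-maxW w)

∈⇒≤maxW : ∀ {x} w → x ∈ w → x ≤ maxW w
∈⇒≤maxW w = All.lookup (All-≤-maxW w)

maxW-lub : ∀ {n} w → All (_≤ n) w → maxW w ≤ n
maxW-lub [] [] = z≤n
maxW-lub (x ∷ w) (x≤n ∷ w≤n) = ⊔-lub x≤n (maxW-lub w w≤n)

removeAll : ℕ → Word → Word
removeAll m [] = []
removeAll m (x ∷ w) = if x ≡ᵇ m then removeAll m w else x ∷ removeAll m w

-- The helper that redV' uses is local to its `where` block; it is named here by letting
-- unification solve a metavariable from its defining equations.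
mutual
  private
    redV'-helper : Word → ℕ → Word → Word
    redV'-helper = _

    redV'-unfold : ∀ x w → redV' (x ∷ w)
                 ≡ (if x ≡ᵇ (x ⊔ maxW w) then redV'-helper (x ∷ w) (x ⊔ maxW w) w
                    else x ∷ redV'-helper (x ∷ w) (x ⊔ maxW w) w)
    redV'-unfold x w with x ⊔ maxW w | x ∷ w
    ... | m | t = refl

redV'-helper≡removeAll : ∀ t m w → redV'-helper t m w ≡ removeAll m w
redV'-helper≡removeAll t m [] = refl
redV'-helper≡removeAll t m (x ∷ w) with x ≡ᵇ m
... | true  = redV'-helper≡removeAll t m w
... | false = cong (x ∷_) (redV'-helper≡removeAll t m w)

redV'≡removeAll : ∀ v → redV' v ≡ removeAll (maxW v) v
redV'≡removeAll v = redV'-helper≡removeAll v (maxW v) v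

∈-removeAll : ∀ {x} m w → x ∈ w → x ≢ m → x ∈ removeAll m w
∈-removeAll {x} m (y ∷ w) x∈y∷w x≢m with y ≡ᵇ m | ≡ᵇ-reflects-≡ y m | x∈y∷w
... | true  | ofʸ refl | here refl = ⊥-elim (x≢m refl)
... | true  | ofʸ _    | there x∈w = ∈-removeAll m w x∈w x≢m
... | false | ofⁿ _    | here refl = here refl
... | false | ofⁿ _    | there x∈w = there (∈-removeAll m w x∈w x≢m)

All-≤-removeAll : ∀ k w → All (_≤ suc k) w → All (_≤ k) (removeAll (suc k) w)
All-≤-removeAll k [] [] = []
All-≤-removeAll k (x ∷ w) (x≤1+k ∷ w≤1+k) with x ≡ᵇ suc k | ≡ᵇ-reflects-≡ x (suc k)
... | true  | ofʸ _   = All-≤-removeAll k w w≤1+k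
... | false | ofⁿ x≢1+k = s≤s⁻¹ (≤∧≢⇒< x≤1+k x≢1+k) ∷ All-≤-removeAll k w w≤1+k

maxW-removeAll : ∀ {k} v → Packed v → maxW v ≡ suc k → maxW (removeAll (suc k) v) ≡ k
maxW-removeAll {k} v (_ , covers) max≡ = ≤-antisym
  (maxW-lub _ (All-≤-removeAll k v (subst (λ n → All (_≤ n) v) max≡ (All-≤-maxW v))))
  (≤maxW k (≤-reflexive (sym max≡)))
  where
  ≤maxW : ∀ j → suc j ≤ maxW v → j ≤ maxW (removeAll (suc j) v)
  ≤maxW zero    _ = z≤n
  ≤maxW (suc j) h = ∈⇒≤maxW _ (∈-removeAll (suc (suc j)) v (covers (suc j) (s≤s z≤n) (<⇒≤ h)) (λ ()))

replaceLetter : ℕ → ℕ → ℕ → ℕ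
replaceLetter m n x = if x ≡ᵇ m then n else x

phiAux-falses : ∀ N (u : Word) I w → phiAux N (replicate (length u) false ++ I) (u ++ w) ≡ u ++ phiAux N I w
phiAux-falses N [] I w = refl
phiAux-falses N (x ∷ u) I w = cong (x ∷_) (phiAux-falses N u I w)

phiAux-removeAll : ∀ N m v → phiAux N (map (_≡ᵇ m) v) (removeAll m v) ≡ map (replaceLetter m (suc N)) v
phiAux-removeAll N m [] = refl
phiAux-removeAll N m (x ∷ v) with x ≡ᵇ m
... | true  = cong (suc N ∷_) (phiAux-removeAll N m v)
... | false = cong (x ∷_) (phiAux-removeAll N m v)

◁R-closed : ∀ {m k} a v → maxW v ≡ m → maxW (removeAll m v) ≡ k
          → a ◁R v ≡ shiftW k a ++ map (replaceLetter m (suc (k + maxW a))) v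
◁R-closed a v refl refl = begin
  φ (falses (length a) ++ redI v) (a ⊙ redV' v)
    ≡⟨ cong (λ r → φ (falses (length a) ++ redI v) (a ⊙ r)) (redV'≡removeAll v) ⟩
  phiAux N (falses (length a) ++ redI v) (shiftW k a ++ r)
    ≡⟨ cong (λ n → phiAux N (falses n ++ redI v) (shiftW k a ++ r)) (length-map (k +_) a) ⟨
  phiAux N (falses (length (shiftW k a)) ++ redI v) (shiftW k a ++ r)
    ≡⟨ phiAux-falses N (shiftW k a) (redI v) r ⟩
  shiftW k a ++ phiAux N (redI v) r
    ≡⟨ cong (shiftW k a ++_) (phiAux-removeAll N (maxW v) v) ⟩
  shiftW k a ++ map (replaceLetter (maxW v) (suc N)) v
    ≡⟨ cong (λ n → shiftW k a ++ map (replaceLetter (maxW v) (suc n)) v) (maxW-⊙ a r) ⟩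
  shiftW k a ++ map (replaceLetter (maxW v) (suc (k + maxW a))) v
    ∎
  where
  open ≡-Reasoning
  falses : ℕ → List Bool
  falses n = replicate n false

  r : Word
  r = removeAll (maxW v) v

  k N : ℕ
  k = maxW r
  N = maxW (a ⊙ r)

◁R-packed : ∀ {k} a v → Packed v → maxW v ≡ suc k
          → a ◁R v ≡ shiftW k a ++ map (replaceLetter (suc k) (suc k + maxW a)) v
◁R-packed a v pv max≡ = ◁R-closed a v max≡ (maxW-removeAll v pv max≡)

raiseFrom : ℕ → ℕ → ℕ
raiseFrom j y = if j ≤ᵇ y then suc y else y

lowerAbove : ℕ → ℕ → ℕ
lowerAbove i x = if i <ᵇ x then x ∸ 1 else x

raiseFrom-< : ∀ {j y} → y < j → raiseFrom j y ≡ y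
raiseFrom-< {j} {y} y<j with j ≤ᵇ y | ≤ᵇ-reflects-≤ j y
... | true  | ofʸ j≤y = ⊥-elim (<⇒≱ y<j j≤y)
... | false | ofⁿ _   = refl

raiseFrom-≥ : ∀ {j y} → j ≤ y → raiseFrom j y ≡ suc y
raiseFrom-≥ {j} {y} j≤y with j ≤ᵇ y | ≤ᵇ-reflects-≤ j y
... | true  | ofʸ _   = refl
... | false | ofⁿ j≰y = ⊥-elim (j≰y j≤y)

raiseFrom-lowerAbove : ∀ i n x → x ≢ i → raiseFrom (i + n) (n + lowerAbove i x) ≡ n + x
raiseFrom-lowerAbove i n x x≢i with i <ᵇ x | <ᵇ-reflects-< i x
raiseFrom-lowerAbove i n (suc x) _ | true | ofʸ i<1+x =
  trans (raiseFrom-≥ (≤-trans (+-monoˡ-≤ n (s≤s⁻¹ i<1+x)) (≤-reflexive (+-comm x n)))) (sym (+-suc n x))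
raiseFrom-lowerAbove i n x x≢i | false | ofⁿ i≮x =
  raiseFrom-< (≤-trans (+-monoʳ-< n (≤∧≢⇒< (≮⇒≥ i≮x) x≢i)) (≤-reflexive (+-comm n i)))

occurs≡false⇒All≢ : ∀ i w → occurs i w ≡ false → All (_≢ i) w
occurs≡false⇒All≢ i [] _ = []
occurs≡false⇒All≢ i (x ∷ w) occ with x ≡ᵇ i | ≡ᵇ-reflects-≡ x i
... | false | ofⁿ x≢i = x≢i ∷ occurs≡false⇒All≢ i w occ

initLast-∷ʳ : ∀ (p : Word) i → initLast (p ++ [ i ]) ≡ p ∷ʳ′ i
initLast-∷ʳ [] i = refl
initLast-∷ʳ (x ∷ p) i with initLast (p ++ [ i ]) | initLast-∷ʳ p i
... | _ | refl = refl

unsnoc-∷ʳ : ∀ (p : Word) i → unsnoc (p ++ [ i ]) ≡ just (p , i)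
unsnoc-∷ʳ p i rewrite initLast-∷ʳ p i = refl

◁B-∷ʳ : ∀ b p {i} → 1 ≤ i → b ◁B (p ++ [ i ]) ≡ p ⊙ b ++ [ maxW b + i ]
◁B-∷ʳ b p {i} i≥1 with unsnoc (p ++ [ i ]) | unsnoc-∷ʳ p i
... | _ | refl with occurs i p in occ
... | true  = cong (λ n → p ⊙ b ++ [ n ]) (+-comm i (maxW b))
... | false = cong₂ (λ w n → w ++ [ n ]) raise-lower (+-comm i (maxW b))
  where
  raise-lower : map (raiseFrom (i + maxW b)) (map (lowerAbove i) p ⊙ b) ≡ p ⊙ b
  raise-lower = begin
    map (raiseFrom (i + maxW b)) (shiftW (maxW b) (map (lowerAbove i) p) ++ b)
      ≡⟨ map-++ _ (shiftW (maxW b) (map (lowerAbove i) p)) b ⟩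
    map (raiseFrom (i + maxW b)) (shiftW (maxW b) (map (lowerAbove i) p)) ++ map (raiseFrom (i + maxW b)) b
      ≡⟨ cong₂ _++_ (trans (map-∘ p) (cong (map _) (map-∘ p))) refl ⟨
    map (raiseFrom (i + maxW b) ∘ (maxW b +_) ∘ lowerAbove i) p ++ map (raiseFrom (i + maxW b)) b
      ≡⟨ cong₂ _++_ (map-cong-local (All.map (raiseFrom-lowerAbove i (maxW b) _) (occurs≡false⇒All≢ i p occ)))
                    (map-id-local (All.map (λ y≤mb → raiseFrom-< (≤-trans (s≤s y≤mb) (+-monoˡ-≤ (maxW b) i≥1)))
                                           (All-≤-maxW b))) ⟩
    shiftW (maxW b) p ++ b
      ∎
    where open ≡-Reasoning

maxW-⊙-∷ʳ : ∀ b p i → maxW (p ⊙ b ++ [ maxW b + i ]) ≡ maxW b + maxW (p ++ [ i ])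
maxW-⊙-∷ʳ b p i = begin
  maxW (p ⊙ b ++ [ maxW b + i ])  ≡⟨ maxW-∷ʳ (p ⊙ b) _ ⟩
  maxW (p ⊙ b) ⊔ (maxW b + i)     ≡⟨ cong (_⊔ (maxW b + i)) (maxW-⊙ p b) ⟩
  (maxW b + maxW p) ⊔ (maxW b + i) ≡⟨ +-distribˡ-⊔ (maxW b) (maxW p) i ⟨
  maxW b + (maxW p ⊔ i)           ≡⟨ cong (maxW b +_) (maxW-∷ʳ p i) ⟨
  maxW b + maxW (p ++ [ i ])      ∎
  where open ≡-Reasoning

⊙-∷ʳ-packed : ∀ b p i → Packed b → Packed (p ++ [ i ]) → Packed (p ⊙ b ++ [ maxW b + i ])
⊙-∷ʳ-packed b p i (b-pos , b-covers) (c-pos , c-covers) = positive , covers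
  where
  mb : ℕ
  mb = maxW b

  i≥1 : 1 ≤ i
  i≥1 = All.head (All.++⁻ʳ p c-pos)

  positive : All (1 ≤_) (p ⊙ b ++ [ mb + i ])
  positive = All.++⁺ (All.++⁺ (All.map⁺ (All.map (λ {x} x≥1 → ≤-trans x≥1 (m≤n+m x mb)) (All.++⁻ˡ p c-pos))) b-pos)
                     (≤-trans i≥1 (m≤n+m i mb) ∷ [])

  shift-∈ : ∀ {x} → x ∈ p ++ [ i ] → mb + x ∈ p ⊙ b ++ [ mb + i ]
  shift-∈ x∈c with ∈-++⁻ p x∈c
  ... | inj₁ x∈p       = ∈-++⁺ˡ (∈-++⁺ˡ (∈-map⁺ (mb +_) x∈p))
  ... | inj₂ (here refl) = ∈-++⁺ʳ (p ⊙ b) (here refl)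

  covers : ∀ j → 1 ≤ j → j ≤ maxW (p ⊙ b ++ [ mb + i ]) → j ∈ p ⊙ b ++ [ mb + i ]
  covers j j≥1 j≤max with ≤-<-connex j mb
  ... | inj₁ j≤mb = ∈-++⁺ˡ (∈-++⁺ʳ (shiftW mb p) (b-covers j j≥1 j≤mb))
  ... | inj₂ mb<j = subst (_∈ p ⊙ b ++ [ mb + i ]) (m+[n∸m]≡n (<⇒≤ mb<j))
    (shift-∈ (c-covers (j ∸ mb) (m<n⇒0<n∸m mb<j)
      (m≤n+o⇒m∸n≤o j mb (≤-trans j≤max (≤-reflexive (maxW-⊙-∷ʳ b p i))))))

replaceLetter-preserves : ∀ (P : ℕ → Set) {m n x} → P x → P n → P (replaceLetter m n x)
replaceLetter-preserves P {m} {n} {x} Px Pn with x ≡ᵇ m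
... | true  = Pn
... | false = Px

replaceLetter-≢ : ∀ {m n x} → x ≢ m → replaceLetter m n x ≡ x
replaceLetter-≢ {m} {n} {x} x≢m with x ≡ᵇ m | ≡ᵇ-reflects-≡ x m
... | true  | ofʸ x≡m = ⊥-elim (x≢m x≡m)
... | false | ofⁿ _   = refl

replaceLetter-+ : ∀ k m n x → replaceLetter (k + m) (k + n) (k + x) ≡ k + replaceLetter m n x
replaceLetter-+ k m n x with k + x ≡ᵇ k + m | ≡ᵇ-reflects-≡ (k + x) (k + m) | x ≡ᵇ m | ≡ᵇ-reflects-≡ x m
... | true  | ofʸ _      | true  | ofʸ _    = refl
... | false | ofⁿ _      | false | ofⁿ _    = refl
... | true  | ofʸ k+x≡k+m | false | ofⁿ x≢m = ⊥-elim (x≢m (+-cancelˡ-≡ k x m k+x≡k+m))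
... | false | ofⁿ k+x≢k+m | true  | ofʸ x≡m = ⊥-elim (k+x≢k+m (cong (k +_) x≡m))

map-replaceLetter-shiftW : ∀ k m n w
                         → map (replaceLetter (k + m) (k + n)) (shiftW k w) ≡ shiftW k (map (replaceLetter m n) w)
map-replaceLetter-shiftW k m n [] = refl
map-replaceLetter-shiftW k m n (x ∷ w) = cong₂ _∷_ (replaceLetter-+ k m n x) (map-replaceLetter-shiftW k m n w)

shiftW-+ : ∀ m n w → shiftW (m + n) w ≡ shiftW m (shiftW n w)
shiftW-+ m n w = trans (map-cong (+-assoc m n) w) (map-∘ w)

++-⊙ : ∀ u v w → (u ++ v) ⊙ w ≡ shiftW (maxW w) u ++ v ⊙ w
++-⊙ u v w = trans (cong (_++ w) (map-++ (maxW w +_) u v)) (++-assoc (shiftW (maxW w) u) (shiftW (maxW w) v) w)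

◁R-◁B-comm-∷ʳ : ∀ a b p i → Packed b → Packed (p ++ [ i ]) → a ◁R (b ◁B (p ++ [ i ])) ≡ b ◁B (a ◁R (p ++ [ i ]))
◁R-◁B-comm-∷ʳ a b p i pb pc = begin
  a ◁R (b ◁B (p ++ [ i ]))
    ≡⟨ cong (a ◁R_) (◁B-∷ʳ b p i≥1) ⟩
  a ◁R d
    ≡⟨ ◁R-packed a d (⊙-∷ʳ-packed b p i pb pc) d-max ⟩
  shiftW (mb + k) a ++ map (replaceLetter (suc (mb + k)) (suc (mb + k) + ma)) d
    ≡⟨ cong₂ _++_ (shiftW-+ mb k a) replace-d ⟩
  shiftW mb (shiftW k a) ++ map r p ⊙ b ++ [ mb + r i ]
    ≡⟨ trans (cong (_++ [ mb + r i ]) (++-⊙ (shiftW k a) (map r p) b)) (++-assoc (shiftW mb (shiftW k a)) (map r p ⊙ b) _) ⟨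
  (shiftW k a ++ map r p) ⊙ b ++ [ mb + r i ]
    ≡⟨ ◁B-∷ʳ b (shiftW k a ++ map r p) (replaceLetter-preserves (1 ≤_) i≥1 (s≤s z≤n)) ⟨
  b ◁B ((shiftW k a ++ map r p) ++ [ r i ])
    ≡⟨ cong (b ◁B_) (trans (++-assoc (shiftW k a) (map r p) [ r i ]) (cong (shiftW k a ++_) (sym (map-++ r p [ i ])))) ⟩
  b ◁B (shiftW k a ++ map r (p ++ [ i ]))
    ≡⟨ cong (b ◁B_) (◁R-packed a (p ++ [ i ]) pc c-max) ⟨
  b ◁B (a ◁R (p ++ [ i ]))
    ∎
  where
  open ≡-Reasoning
  ma mb k : ℕ
  ma = maxW a
  mb = maxW b
  k = maxW (p ++ [ i ]) ∸ 1

  d : Word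
  d = p ⊙ b ++ [ mb + i ]

  r : ℕ → ℕ
  r = replaceLetter (suc k) (suc k + ma)

  i≥1 : 1 ≤ i
  i≥1 = All.head (All.++⁻ʳ p (proj₁ pc))

  c-max : maxW (p ++ [ i ]) ≡ suc k
  c-max = sym (m+[n∸m]≡n (≤-trans i≥1 (∈⇒≤maxW (p ++ [ i ]) (∈-++⁺ʳ p (here refl)))))

  d-max : maxW d ≡ suc (mb + k)
  d-max = trans (maxW-⊙-∷ʳ b p i) (trans (cong (mb +_) c-max) (+-suc mb k))

  replace-d : map (replaceLetter (suc (mb + k)) (suc (mb + k) + ma)) d ≡ map r p ⊙ b ++ [ mb + r i ]
  replace-d = begin
    map (replaceLetter (suc (mb + k)) (suc (mb + k) + ma)) d
      ≡⟨ cong (λ f → map f d) (cong₂ replaceLetter (sym (+-suc mb k)) (trans (cong suc (+-assoc mb k ma)) (sym (+-suc mb (k + ma))))) ⟩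
    map R ((shiftW mb p ++ b) ++ [ mb + i ])
      ≡⟨ trans (map-++ R (shiftW mb p ++ b) _) (cong (_++ map R [ mb + i ]) (map-++ R (shiftW mb p) b)) ⟩
    (map R (shiftW mb p) ++ map R b) ++ map R (shiftW mb [ i ])
      ≡⟨ cong₂ _++_ (cong₂ _++_ (map-replaceLetter-shiftW mb (suc k) (suc k + ma) p) R-fixes-b)
                    (map-replaceLetter-shiftW mb (suc k) (suc k + ma) [ i ]) ⟩
    map r p ⊙ b ++ [ mb + r i ]
      ∎
    where
    R : ℕ → ℕ
    R = replaceLetter (mb + suc k) (mb + (suc k + ma))

    R-fixes-b : map R b ≡ b
    R-fixes-b = map-id-local (All.map (λ y≤mb → replaceLetter-≢ (λ y≡ → m+1+n≰m mb (≤-trans (≤-reflexive (sym y≡)) y≤mb)))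
                                      (All-≤-maxW b))

◁R-[1]≡◁B-[1] : ∀ a → a ◁R [ 1 ] ≡ a ◁B [ 1 ]
◁R-[1]≡◁B-[1] a = begin
  a ◁R [ 1 ]                     ≡⟨ ◁R-closed a [ 1 ] refl refl ⟩
  shiftW 0 a ++ [ suc (maxW a) ] ≡⟨ cong₂ (λ w n → w ++ [ n ]) (map-id a) (+-comm 1 (maxW a)) ⟩
  a ++ [ maxW a + 1 ]            ≡⟨ ◁B-∷ʳ a [] ≤-refl ⟨
  a ◁B [ 1 ]                     ∎
  where open ≡-Reasoning

≢[]⇒∷ʳ : ∀ (c : Word) → c ≢ [] → ∃₂ λ p i → c ≡ p ++ [ i ]
≢[]⇒∷ʳ c c≢[] with initLast c
... | []      = ⊥-elim (c≢[] refl)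
... | p ∷ʳ′ i = p , i , refl

mainTheorem13 : ((a b c : Word) → Packed a → Packed b → Packed c → c ≢ []
    → a ◁R (b ◁B c) ≡ b ◁B (a ◁R c))
    × ((a : Word) → Packed a → a ◁R [ 1 ] ≡ a ◁B [ 1 ])
mainTheorem13 = commute , λ a _ → ◁R-[1]≡◁B-[1] a
  where
  commute : (a b c : Word) → Packed a → Packed b → Packed c → c ≢ [] → a ◁R (b ◁B c) ≡ b ◁B (a ◁R c)
  commute a b c _ pb pc c≢[] with ≢[]⇒∷ʳ c c≢[]
  ... | p , i , refl = ◁R-◁B-comm-∷ʳ a b p i pb pc
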